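{- Let agents $N=[n]$ have matroid rank valuations over a finite set of goods $G$, and let $X$ and $Y$ be two non-redundant allocations for the set of agents $N\cup\{0\}$. Let $S^-=\{i\in N\cup\{0\}: |X_i|<|Y_i|\}$, $S^==\{i\in N\cup\{0\}:|X_i|=|Y_i|\}$ and $S^+=\{i\in N\cup\{0\}:|X_i|>|Y_i|\}$. Then for any agent $i\in S^-$, there exists a transfer path in $X$ from $i$ to some agent $k\in S^+$.
   Context: A valuation $v:2^G\to\mathbb{R}_{\ge 0}$ is a matroid rank valuation if $v(\emptyset)=0$, $v(S\cup\{g\})-v(S)\in\{0,1\}$ for all $S,g$, and $v$ is submodular. An allocation is a partition $X=(X_0,X_1,\dots,X_n)$ of $G$, where $X_0$ is the set of unallocated goods, held by a dummy agent $0$ with valuation $v_0(S)=|S|$. An allocation is non-redundant if $v_i(X_i)=|X_i|$ for all $i\in N\cup\{0\}$. A transfer path from agent $i$ to agent $j$ in $X$ is a sequence of distinct goods $(g_1,\dots,g_k)$ with $g_k\in X_j$ such that, if $X'$ is obtained by moving $g_k$ to the owner (in $X$) of $g_{k-1}$, ..., $g_2$ to the owner of $g_1$, and $g_1$ to $i$, then $v_i(X'_i)=v_i(X_i)+1$, $v_j(X'_j)=v_j(X_j)-1$, and $v_h(X'_h)=v_h(X_h)$ for all other agents $h$. -}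

module Defs where

open import Data.Nat using (ℕ; suc; _+_; _≤_; _<_)
open import Data.Fin using (Fin; zero; suc; _≟_)
open import Data.Fin.Subset using (Subset; ⊥; ⁅_⁆; _∩_; _∪_; ∣_∣)
open import Data.Vec using (tabulate)
open import Data.List using (List; []; _∷_; _∷ʳ_)
open import Data.List.Relation.Unary.Unique.Propositional using (Unique)
open import Data.Product using (_×_)
open import Data.Sum using (_⊎_)
open import Relation.Binary.PropositionalEquality using (_≡_; _≢_)
open import Relation.Nullary.Decidable using (⌊_⌋; yes; no)

record IsMatroidRank {m : ℕ} (v : Subset m → ℕ) : Set where
  field
    empty      : v ⊥ ≡ 0
    marginal   : ∀ (S : Subset m) (g : Fin m) →
                   v (S ∪ ⁅ g ⁆) ≡ v S ⊎ v (S ∪ ⁅ g ⁆) ≡ suc (v S)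
    submodular : ∀ (S T : Subset m) → v (S ∪ T) + v (S ∩ T) ≤ v S + v T

-- Agents N ∪ {0} = Fin (suc n); agent zero is the dummy agent 0,
-- agent (suc i) is the real agent i ∈ Fin n.
Agent : ℕ → Set
Agent n = Fin (suc n)

V : ∀ {n m} → (Fin n → Subset m → ℕ) → Agent n → Subset m → ℕ
V val zero    S = ∣ S ∣
V val (suc i) S = val i S

-- An allocation (partition of G among N ∪ {0}) assigns every good its owner.
Allocation : ℕ → ℕ → Set
Allocation n m = Fin m → Agent n

bundle : ∀ {n m} → Allocation n m → Agent n → Subset m
bundle X i = tabulate (λ g → ⌊ X g ≟ i ⌋)

NonRedundant : ∀ {n m} → (Fin n → Subset m → ℕ) → Allocation n m → Set
NonRedundant val X = ∀ i → V val i (bundle X i) ≡ ∣ bundle X i ∣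

-- Perform the transfers along a path (g₁, …, g_k):
-- g₁ goes to the target t (= agent i), g_{l+1} goes to the owner in X of g_l.
reassign : ∀ {n m} → Allocation n m → Agent n → List (Fin m) → Allocation n m
reassign X t []       g = X g
reassign X t (h ∷ hs) g with g ≟ h
... | yes _ = t
... | no  _ = reassign X (X h) hs g

transferAlong : ∀ {n m} → Allocation n m → Agent n → List (Fin m) → Allocation n m
transferAlong X i path = reassign X i path

-- A transfer path from i to j in X: the nonempty list of distinct goods
-- gs ∷ʳ gk = (g₁, …, g_k) with g_k ∈ X_j, with the stated value changes.
IsTransferPath : ∀ {n m} → (Fin n → Subset m → ℕ) → Allocation n m →
                 Agent n → Agent n → List (Fin m) → Fin m → Set
IsTransferPath val X i j gs gk =
  Unique (gs ∷ʳ gk) ×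
  X gk ≡ j ×
  V val i (bundle X' i) ≡ suc (V val i (bundle X i)) ×
  suc (V val j (bundle X' j)) ≡ V val j (bundle X j) ×
  (∀ h → h ≢ i → h ≢ j → V val h (bundle X' h) ≡ V val h (bundle X h))
  where X' = transferAlong X i (gs ∷ʳ gk)

{-# OPTIONS --safe #-}
-- By matroid augmentation, |X i| < |Y i| yields a good g ∈ Y i ∖ X i whose transfer to i
-- raises v i by one. If its owner a = X g lies in S⁺, then (g) is the transfer path.
-- Otherwise moving g to i keeps the allocation non-redundant and puts a into S⁻, so we
-- recurse from a and prepend g to the path found there. The recursion terminates because
-- the set of goods on which the allocation disagrees with Y shrinks at each step.
module Submission where

open import Defs
open import Algebra.Bundles using (CommutativeMonoid)
import Algebra.Properties.CommutativeSemigroup as CommutativeSemigroupProperties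
open import Data.Nat using (ℕ; suc; _+_; _≤_; _<_; s≤s; _<?_)
open import Data.Nat.Properties
  using ( ≤-reflexive; ≤-trans; ≤-antisym; ≤-pred; n≤1+n; 1+n≢n; +-suc; +-cancelʳ-≤; +-mono-≤; +-monoʳ-≤
        ; <⇒≱; <-≤-trans; <-irrefl; <-asym; ≮⇒≥; module ≤-Reasoning)
  renaming (_≟_ to _≟ℕ_)
open import Data.Fin using (Fin; zero; suc; _≟_)
open import Data.Fin.Properties using (any?)
open import Data.Fin.Subset
open import Data.Fin.Subset.Properties
open import Data.Fin.Subset.Induction using (⊂-wellFounded)
open import Data.List using (List; []; _∷_; _∷ʳ_)
open import Data.List.Relation.Unary.All as All using (All; []; _∷_)
open import Data.List.Relation.Unary.AllPairs using ([]; _∷_)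
open import Data.Product using (Σ; ∃; _×_; _,_)
open import Data.Sum using (_⊎_; inj₁; inj₂)
open import Data.Vec using ([]; _∷_; here; there; tabulate)
open import Data.Vec.Properties using ([]=⇒lookup; lookup⇒[]=; lookup∘tabulate; tabulate-cong)
open import Function using (_∘_; flip)
open import Induction.WellFounded as WF using (Acc; acc)
open import Level using (Level)
open import Relation.Nullary using (Dec; yes; no; ¬?; contradiction; _×-dec_)
open import Relation.Nullary.Decidable using (⌊_⌋; isYes≗does; dec-true)
open import Relation.Unary using (Pred; Decidable)
open import Relation.Binary.PropositionalEquality

private variable
  ℓ : Level
  k : ℕ

x∈p─q⇒x∉q : ∀ (p q : Subset k) {x} → x ∈ p ─ q → x ∉ q
x∈p─q⇒x∉q (_ ∷ p) (inside  ∷ q) {zero}  ()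
x∈p─q⇒x∉q (_ ∷ p) (outside ∷ q) {zero}  _ ()
x∈p─q⇒x∉q (_ ∷ p) (_       ∷ q) {suc x} (there x∈p─q) (there x∈q) = x∈p─q⇒x∉q p q x∈p─q x∈q

x∉p-x : ∀ (p : Subset k) x → x ∉ p - x
x∉p-x p x x∈p-x = x∈p─q⇒x∉q p ⁅ x ⁆ x∈p-x (x∈⁅x⁆ x)

x∉p⇒∣p∪⁅x⁆∣≡1+∣p∣ : ∀ (p : Subset k) x → x ∉ p → ∣ p ∪ ⁅ x ⁆ ∣ ≡ suc ∣ p ∣
x∉p⇒∣p∪⁅x⁆∣≡1+∣p∣ (inside  ∷ p) zero    x∉p = contradiction here x∉p
x∉p⇒∣p∪⁅x⁆∣≡1+∣p∣ (outside ∷ p) zero    _   = cong (suc ∘ ∣_∣) (∪-identityʳ p)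
x∉p⇒∣p∪⁅x⁆∣≡1+∣p∣ (inside  ∷ p) (suc x) x∉p = cong suc (x∉p⇒∣p∪⁅x⁆∣≡1+∣p∣ p x (x∉p ∘ there))
x∉p⇒∣p∪⁅x⁆∣≡1+∣p∣ (outside ∷ p) (suc x) x∉p = x∉p⇒∣p∪⁅x⁆∣≡1+∣p∣ p x (x∉p ∘ there)

x∈p⇒1+∣p-x∣≡∣p∣ : ∀ (p : Subset k) {x} → x ∈ p → suc ∣ p - x ∣ ≡ ∣ p ∣
x∈p⇒1+∣p-x∣≡∣p∣ (inside  ∷ p) here        = cong (suc ∘ ∣_∣) (p─⊥≡p p)
x∈p⇒1+∣p-x∣≡∣p∣ (inside  ∷ p) (there x∈p) = cong suc (x∈p⇒1+∣p-x∣≡∣p∣ p x∈p)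
x∈p⇒1+∣p-x∣≡∣p∣ (outside ∷ p) (there x∈p) = x∈p⇒1+∣p-x∣≡∣p∣ p x∈p

∣p∪q∣+∣p∩q∣≡∣p∣+∣q∣ : ∀ (p q : Subset k) → ∣ p ∪ q ∣ + ∣ p ∩ q ∣ ≡ ∣ p ∣ + ∣ q ∣
∣p∪q∣+∣p∩q∣≡∣p∣+∣q∣ []            []            = refl
∣p∪q∣+∣p∩q∣≡∣p∣+∣q∣ (inside  ∷ p) (inside  ∷ q) =
  cong suc (trans (+-suc _ _) (trans (cong suc (∣p∪q∣+∣p∩q∣≡∣p∣+∣q∣ p q)) (sym (+-suc _ _))))
∣p∪q∣+∣p∩q∣≡∣p∣+∣q∣ (inside  ∷ p) (outside ∷ q) = cong suc (∣p∪q∣+∣p∩q∣≡∣p∣+∣q∣ p q)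
∣p∪q∣+∣p∩q∣≡∣p∣+∣q∣ (outside ∷ p) (inside  ∷ q) = trans (cong suc (∣p∪q∣+∣p∩q∣≡∣p∣+∣q∣ p q)) (sym (+-suc _ _))
∣p∪q∣+∣p∩q∣≡∣p∣+∣q∣ (outside ∷ p) (outside ∷ q) = ∣p∪q∣+∣p∩q∣≡∣p∣+∣q∣ p q

x∈p⇒p∪⁅x⁆≡p : ∀ {p : Subset k} {x} → x ∈ p → p ∪ ⁅ x ⁆ ≡ p
x∈p⇒p∪⁅x⁆≡p {p = p} {x} x∈p = ⊆-antisym p∪⁅x⁆⊆p (p⊆p∪q ⁅ x ⁆)
  where
  p∪⁅x⁆⊆p : p ∪ ⁅ x ⁆ ⊆ p
  p∪⁅x⁆⊆p y∈ with x∈p∪q⁻ p ⁅ x ⁆ y∈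
  ... | inj₁ y∈p   = y∈p
  ... | inj₂ y∈⁅x⁆ = subst (_∈ p) (sym (x∈⁅y⁆⇒x≡y x y∈⁅x⁆)) x∈p

x∈p⇒p-x∪⁅x⁆≡p : ∀ {p : Subset k} {x} → x ∈ p → (p - x) ∪ ⁅ x ⁆ ≡ p
x∈p⇒p-x∪⁅x⁆≡p {p = p} {x} x∈p = ⊆-antisym ⊆p p⊆
  where
  ⊆p : (p - x) ∪ ⁅ x ⁆ ⊆ p
  ⊆p y∈ with x∈p∪q⁻ (p - x) ⁅ x ⁆ y∈
  ... | inj₁ y∈p-x = p─q⊆p p ⁅ x ⁆ y∈p-x
  ... | inj₂ y∈⁅x⁆ = subst (_∈ p) (sym (x∈⁅y⁆⇒x≡y x y∈⁅x⁆)) x∈p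
  p⊆ : p ⊆ (p - x) ∪ ⁅ x ⁆
  p⊆ {y} y∈p with y ≟ x
  ... | yes refl = q⊆p∪q (p - x) ⁅ x ⁆ (x∈⁅x⁆ x)
  ... | no  y≢x  = p⊆p∪q ⁅ x ⁆ (x∈p∧x≢y⇒x∈p-y y∈p y≢x)

insertion-induction : (P : Subset k → Set ℓ) → P ⊥ →
                      (∀ p x → x ∉ p → P p → P (p ∪ ⁅ x ⁆)) → ∀ p → P p
insertion-induction {ℓ = ℓ} P P⊥ insert = WF.All.wfRec ⊂-wellFounded ℓ P step
  where
  step : ∀ p → (∀ {q} → q ⊂ p → P q) → P p
  step p ih with nonempty? p
  ... | no  p-empty   = subst P (sym (Empty-unique p-empty)) P⊥
  ... | yes (x , x∈p) = subst P (x∈p⇒p-x∪⁅x⁆≡p x∈p)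
                              (insert (p - x) x (x∉p-x p x) (ih (x∈p⇒p-x⊂p x∈p)))

∪-distribˡ-∪ : ∀ (p q r : Subset k) → p ∪ (q ∪ r) ≡ (p ∪ q) ∪ (p ∪ r)
∪-distribˡ-∪ {k} p q r = begin
  p ∪ (q ∪ r)         ≡⟨ cong (_∪ (q ∪ r)) (∪-idem p) ⟨
  (p ∪ p) ∪ (q ∪ r)   ≡⟨ interchange p p q r ⟩
  (p ∪ q) ∪ (p ∪ r)   ∎
  where
  open ≡-Reasoning
  open CommutativeSemigroupProperties (CommutativeMonoid.commutativeSemigroup (∪-commutativeMonoid k))
    using (interchange)

Independent : (Subset k → ℕ) → Subset k → Set
Independent v p = v p ≡ ∣ p ∣

∣∣-isMatroidRank : IsMatroidRank {k} ∣_∣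
∣∣-isMatroidRank {k} = record
  { empty      = ∣⊥∣≡0 k
  ; marginal   = marginal
  ; submodular = λ p q → ≤-reflexive (∣p∪q∣+∣p∩q∣≡∣p∣+∣q∣ p q)
  }
  where
  marginal : ∀ p x → ∣ p ∪ ⁅ x ⁆ ∣ ≡ ∣ p ∣ ⊎ ∣ p ∪ ⁅ x ⁆ ∣ ≡ suc ∣ p ∣
  marginal p x with x ∈? p
  ... | yes x∈p = inj₁ (cong ∣_∣ (x∈p⇒p∪⁅x⁆≡p x∈p))
  ... | no  x∉p = inj₂ (x∉p⇒∣p∪⁅x⁆∣≡1+∣p∣ p x x∉p)

module MatroidRank {v : Subset k → ℕ} (rank : IsMatroidRank v) where
  open IsMatroidRank rank

  rank-∪⁅⁆-≤ : ∀ p x → v (p ∪ ⁅ x ⁆) ≤ suc (v p)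
  rank-∪⁅⁆-≤ p x with marginal p x
  ... | inj₁ same = ≤-trans (≤-reflexive same) (n≤1+n (v p))
  ... | inj₂ up   = ≤-reflexive up

  rank-mono-∪⁅⁆ : ∀ p x → v p ≤ v (p ∪ ⁅ x ⁆)
  rank-mono-∪⁅⁆ p x with marginal p x
  ... | inj₁ same = ≤-reflexive (sym same)
  ... | inj₂ up   = ≤-trans (n≤1+n (v p)) (≤-reflexive (sym up))

  rank≤∣_∣ : ∀ p → v p ≤ ∣ p ∣
  rank≤∣_∣ = insertion-induction (λ p → v p ≤ ∣ p ∣) (≤-reflexive (trans empty (sym (∣⊥∣≡0 k)))) insert
    where
    insert : ∀ p x → x ∉ p → v p ≤ ∣ p ∣ → v (p ∪ ⁅ x ⁆) ≤ ∣ p ∪ ⁅ x ⁆ ∣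
    insert p x x∉p vp≤ = begin
      v (p ∪ ⁅ x ⁆)   ≤⟨ rank-∪⁅⁆-≤ p x ⟩
      suc (v p)       ≤⟨ s≤s vp≤ ⟩
      suc ∣ p ∣       ≡⟨ x∉p⇒∣p∪⁅x⁆∣≡1+∣p∣ p x x∉p ⟨
      ∣ p ∪ ⁅ x ⁆ ∣   ∎
      where open ≤-Reasoning

  rank-mono-∪ : ∀ p q → v p ≤ v (p ∪ q)
  rank-mono-∪ p = insertion-induction (λ q → v p ≤ v (p ∪ q)) (≤-reflexive (cong v (sym (∪-identityʳ p)))) insert
    where
    insert : ∀ q x → x ∉ q → v p ≤ v (p ∪ q) → v p ≤ v (p ∪ (q ∪ ⁅ x ⁆))
    insert q x _ vp≤ = begin
      v p                   ≤⟨ vp≤ ⟩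
      v (p ∪ q)             ≤⟨ rank-mono-∪⁅⁆ (p ∪ q) x ⟩
      v ((p ∪ q) ∪ ⁅ x ⁆)   ≡⟨ cong v (∪-assoc p q ⁅ x ⁆) ⟩
      v (p ∪ (q ∪ ⁅ x ⁆))   ∎
      where open ≤-Reasoning

  independent-remove : ∀ {p x} → x ∈ p → Independent v p → Independent v (p - x)
  independent-remove {p} {x} x∈p indep = ≤-antisym rank≤∣ p - x ∣ (≤-pred (begin
    suc ∣ p - x ∣           ≡⟨ x∈p⇒1+∣p-x∣≡∣p∣ p x∈p ⟩
    ∣ p ∣                   ≡⟨ indep ⟨
    v p                     ≡⟨ cong v (x∈p⇒p-x∪⁅x⁆≡p x∈p) ⟨
    v ((p - x) ∪ ⁅ x ⁆)     ≤⟨ rank-∪⁅⁆-≤ (p - x) x ⟩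
    suc (v (p - x))         ∎))
    where open ≤-Reasoning

  rank-∪-spanned : ∀ p q → (∀ {x} → x ∈ q → v (p ∪ ⁅ x ⁆) ≤ v p) → v (p ∪ q) ≤ v p
  rank-∪-spanned p = insertion-induction P (λ _ → ≤-reflexive (cong v (∪-identityʳ p))) insert
    where
    P : Subset k → Set
    P q = (∀ {x} → x ∈ q → v (p ∪ ⁅ x ⁆) ≤ v p) → v (p ∪ q) ≤ v p
    insert : ∀ q x → x ∉ q → P q → P (q ∪ ⁅ x ⁆)
    insert q x _ ih spanned = +-cancelʳ-≤ (v p) _ _ (begin
      v (p ∪ (q ∪ ⁅ x ⁆)) + v p
        ≤⟨ +-monoʳ-≤ (v (p ∪ (q ∪ ⁅ x ⁆))) (rank-mono-∪ p (q ∩ ⁅ x ⁆)) ⟩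
      v (p ∪ (q ∪ ⁅ x ⁆)) + v (p ∪ (q ∩ ⁅ x ⁆))
        ≡⟨ cong₂ (λ a b → v a + v b) (∪-distribˡ-∪ p q ⁅ x ⁆) (∪-distribˡ-∩ p q ⁅ x ⁆) ⟩
      v ((p ∪ q) ∪ (p ∪ ⁅ x ⁆)) + v ((p ∪ q) ∩ (p ∪ ⁅ x ⁆))
        ≤⟨ submodular (p ∪ q) (p ∪ ⁅ x ⁆) ⟩
      v (p ∪ q) + v (p ∪ ⁅ x ⁆)
        ≤⟨ +-mono-≤ (ih (spanned ∘ p⊆p∪q ⁅ x ⁆)) (spanned (q⊆p∪q q ⁅ x ⁆ (x∈⁅x⁆ x))) ⟩
      v p + v p  ∎)
      where open ≤-Reasoning

  augment : ∀ {p q} → Independent v p → Independent v q → ∣ p ∣ < ∣ q ∣ →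
            ∃ λ x → x ∈ q × x ∉ p × v (p ∪ ⁅ x ⁆) ≡ suc (v p)
  augment {p} {q} indep-p indep-q ∣p∣<∣q∣
    with any? (λ x → (x ∈? q) ×-dec (v (p ∪ ⁅ x ⁆) ≟ℕ suc (v p)))
  ... | yes (x , x∈q , up) = x , x∈q , x∉p , up
    where
    x∉p : x ∉ p
    x∉p x∈p = 1+n≢n (trans (sym up) (cong v (x∈p⇒p∪⁅x⁆≡p x∈p)))
  ... | no  ¬up = contradiction ∣q∣≤∣p∣ (<⇒≱ ∣p∣<∣q∣)
    where
    spanned : ∀ {x} → x ∈ q → v (p ∪ ⁅ x ⁆) ≤ v p
    spanned {x} x∈q with marginal p x
    ... | inj₁ same = ≤-reflexive same
    ... | inj₂ up   = contradiction (x , x∈q , up) ¬up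
    ∣q∣≤∣p∣ : ∣ q ∣ ≤ ∣ p ∣
    ∣q∣≤∣p∣ = begin
      ∣ q ∣       ≡⟨ indep-q ⟨
      v q         ≤⟨ rank-mono-∪ q p ⟩
      v (q ∪ p)   ≡⟨ cong v (∪-comm q p) ⟩
      v (p ∪ q)   ≤⟨ rank-∪-spanned p q spanned ⟩
      v p         ≡⟨ indep-p ⟩
      ∣ p ∣       ∎
      where open ≤-Reasoning

satisfying : {P : Pred (Fin k) ℓ} → Decidable P → Subset k
satisfying P? = tabulate (λ x → ⌊ P? x ⌋)

module _ {P : Pred (Fin k) ℓ} (P? : Decidable P) where

  ∈-satisfying⁺ : ∀ {x} → P x → x ∈ satisfying P?
  ∈-satisfying⁺ {x} Px =
    lookup⇒[]= x _ (trans (lookup∘tabulate _ x) (trans (isYes≗does (P? x)) (dec-true (P? x) Px)))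

  ∈-satisfying⁻ : ∀ {x} → x ∈ satisfying P? → P x
  ∈-satisfying⁻ {x} x∈ with P? x | trans (sym ([]=⇒lookup x∈)) (lookup∘tabulate _ x)
  ... | yes Px | _ = Px
  ... | no  _  | ()

module _ {n m : ℕ} where

  ∈-bundle⁺ : ∀ (X : Allocation n m) {i g} → X g ≡ i → g ∈ bundle X i
  ∈-bundle⁺ X {i} = ∈-satisfying⁺ (λ g → X g ≟ i)

  ∈-bundle⁻ : ∀ (X : Allocation n m) {i g} → g ∈ bundle X i → X g ≡ i
  ∈-bundle⁻ X {i} = ∈-satisfying⁻ (λ g → X g ≟ i)

  bundle-ext : ∀ (X : Allocation n m) {i p} →
               (∀ {g} → X g ≡ i → g ∈ p) → (∀ {g} → g ∈ p → X g ≡ i) → bundle X i ≡ p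
  bundle-ext X to from = ⊆-antisym (to ∘ ∈-bundle⁻ X) (∈-bundle⁺ X ∘ from)

  bundle-cong : ∀ {X X' : Allocation n m} → (∀ g → X g ≡ X' g) → ∀ i → bundle X i ≡ bundle X' i
  bundle-cong X≗X' i = tabulate-cong (λ g → cong (λ a → ⌊ a ≟ i ⌋) (X≗X' g))

  reassign-head : ∀ (X : Allocation n m) t g L → reassign X t (g ∷ L) g ≡ t
  reassign-head X t g L with g ≟ g
  ... | yes _   = refl
  ... | no  g≢g = contradiction refl g≢g

  reassign-tail : ∀ (X : Allocation n m) t g L {h} → h ≢ g →
                  reassign X t (g ∷ L) h ≡ reassign X (X g) L h
  reassign-tail X t g L {h} h≢g with h ≟ g
  ... | yes h≡g = contradiction h≡g h≢g
  ... | no  _   = refl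

  reassign-∉ : ∀ (X : Allocation n m) t L {h} → All (h ≢_) L → reassign X t L h ≡ X h
  reassign-∉ X t []      []            = refl
  reassign-∉ X t (g ∷ L) (h≢g ∷ h∉L) = trans (reassign-tail X t g L h≢g) (reassign-∉ X (X g) L h∉L)

  reassign-cong : ∀ {X X' : Allocation n m} t L {g} → (∀ h → h ≢ g → X h ≡ X' h) →
                  All (g ≢_) L → ∀ {h} → h ≢ g → reassign X t L h ≡ reassign X' t L h
  reassign-cong t [] X≗X' _ h≢g = X≗X' _ h≢g
  reassign-cong {X} {X'} t (l ∷ L) X≗X' (g≢l ∷ g∉L) {h} h≢g with h ≟ l
  ... | yes _ = refl
  ... | no  _ = trans (cong (λ t' → reassign X t' L h) (X≗X' l (g≢l ∘ sym)))
                      (reassign-cong (X' l) L X≗X' g∉L h≢g)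

  move : Allocation n m → Agent n → Fin m → Allocation n m
  move X t g = reassign X t (g ∷ [])

  reassign-∷ : ∀ (X : Allocation n m) t g L → All (g ≢_) L →
               ∀ h → reassign X t (g ∷ L) h ≡ reassign (move X t g) (X g) L h
  reassign-∷ X t g L g∉L h with h ≟ g
  ... | yes refl = sym (trans (reassign-∉ (move X t g) (X g) L g∉L) (reassign-head X t g []))
  ... | no  h≢g  = reassign-cong (X g) L (λ h' h'≢g → sym (reassign-tail X t g [] h'≢g)) g∉L h≢g

  bundle-move-target : ∀ (X : Allocation n m) t g → bundle (move X t g) t ≡ bundle X t ∪ ⁅ g ⁆
  bundle-move-target X t g = bundle-ext (move X t g) to from
    where
    to : ∀ {h} → move X t g h ≡ t → h ∈ bundle X t ∪ ⁅ g ⁆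
    to {h} moved with h ≟ g
    ... | yes refl = q⊆p∪q (bundle X t) ⁅ g ⁆ (x∈⁅x⁆ g)
    ... | no  _    = p⊆p∪q ⁅ g ⁆ (∈-bundle⁺ X moved)
    from : ∀ {h} → h ∈ bundle X t ∪ ⁅ g ⁆ → move X t g h ≡ t
    from {h} h∈ with h ≟ g | x∈p∪q⁻ (bundle X t) ⁅ g ⁆ h∈
    ... | yes refl | _        = refl
    ... | no  _    | inj₁ h∈X = ∈-bundle⁻ X h∈X
    ... | no  h≢g  | inj₂ h∈g = contradiction (x∈⁅y⁆⇒x≡y g h∈g) h≢g

  bundle-move-source : ∀ (X : Allocation n m) t g → X g ≢ t →
                       bundle (move X t g) (X g) ≡ bundle X (X g) - g
  bundle-move-source X t g Xg≢t = bundle-ext (move X t g) to from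
    where
    to : ∀ {h} → move X t g h ≡ X g → h ∈ bundle X (X g) - g
    to {h} kept with h ≟ g
    ... | yes refl = contradiction (sym kept) Xg≢t
    ... | no  h≢g  = x∈p∧x≢y⇒x∈p-y (∈-bundle⁺ X kept) h≢g
    from : ∀ {h} → h ∈ bundle X (X g) - g → move X t g h ≡ X g
    from h∈ = trans (reassign-tail X t g [] (x∉⁅y⁆⇒x≢y (x∈p─q⇒x∉q (bundle X (X g)) ⁅ g ⁆ h∈)))
                    (∈-bundle⁻ X (p─q⊆p (bundle X (X g)) ⁅ g ⁆ h∈))

  bundle-move-other : ∀ (X : Allocation n m) t g {j} → j ≢ t → j ≢ X g →
                      bundle (move X t g) j ≡ bundle X j
  bundle-move-other X t g {j} j≢t j≢Xg = bundle-ext (move X t g) to from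
    where
    to : ∀ {h} → move X t g h ≡ j → h ∈ bundle X j
    to {h} moved with h ≟ g
    ... | yes refl = contradiction (sym moved) j≢t
    ... | no  _    = ∈-bundle⁺ X moved
    from : ∀ {h} → h ∈ bundle X j → move X t g h ≡ j
    from {h} h∈ with h ≟ g
    ... | yes refl = contradiction (sym (∈-bundle⁻ X h∈)) j≢Xg
    ... | no  _    = ∈-bundle⁻ X h∈

  disputed : Allocation n m → Allocation n m → Subset m
  disputed Y X = satisfying (λ g → ¬? (X g ≟ Y g))

  disputed-move-⊂ : ∀ (X Y : Allocation n m) {t g} → Y g ≡ t → X g ≢ t →
                    disputed Y (move X t g) ⊂ disputed Y X
  disputed-move-⊂ X Y {t} {g} Yg≡t Xg≢t = disputed-⊆ , g , ∈-satisfying⁺ _ (Xg≢t ∘ flip trans Yg≡t) , g∉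
    where
    g∉ : g ∉ disputed Y (move X t g)
    g∉ g∈ = ∈-satisfying⁻ _ g∈ (trans (reassign-head X t g []) (sym Yg≡t))
    disputed-⊆ : disputed Y (move X t g) ⊆ disputed Y X
    disputed-⊆ {h} h∈ with h ≟ g
    ... | yes refl = contradiction h∈ g∉
    ... | no  h≢g  = ∈-satisfying⁺ _ (∈-satisfying⁻ _ h∈ ∘ trans (reassign-tail X t g [] h≢g))

module _ {n m : ℕ} {val : Fin n → Subset m → ℕ} (rank : ∀ i → IsMatroidRank (val i)) where

  V-isMatroidRank : ∀ a → IsMatroidRank (V val a)
  V-isMatroidRank zero    = ∣∣-isMatroidRank
  V-isMatroidRank (suc i) = rank i

  module SingleTransfer (X : Allocation n m) (nonRedundant : NonRedundant val X) {i g}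
                        (g∉Xi : g ∉ bundle X i)
                        (gain : V val i (bundle X i ∪ ⁅ g ⁆) ≡ suc (V val i (bundle X i))) where

    a : Agent n
    a = X g

    X' : Allocation n m
    X' = move X i g

    a≢i : a ≢ i
    a≢i a≡i = g∉Xi (∈-bundle⁺ X a≡i)

    g∈Xa : g ∈ bundle X a
    g∈Xa = ∈-bundle⁺ X refl

    source-independent : Independent (V val a) (bundle X' a)
    source-independent rewrite bundle-move-source X i g a≢i =
      MatroidRank.independent-remove (V-isMatroidRank a) g∈Xa (nonRedundant a)

    value-target : V val i (bundle X' i) ≡ suc (V val i (bundle X i))
    value-target = trans (cong (V val i) (bundle-move-target X i g)) gain

    size-target : ∣ bundle X' i ∣ ≡ suc ∣ bundle X i ∣
    size-target = trans (cong ∣_∣ (bundle-move-target X i g)) (x∉p⇒∣p∪⁅x⁆∣≡1+∣p∣ (bundle X i) g g∉Xi)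

    size-source : suc ∣ bundle X' a ∣ ≡ ∣ bundle X a ∣
    size-source = trans (cong (suc ∘ ∣_∣) (bundle-move-source X i g a≢i)) (x∈p⇒1+∣p-x∣≡∣p∣ (bundle X a) g∈Xa)

    value-source : suc (V val a (bundle X' a)) ≡ V val a (bundle X a)
    value-source = trans (cong suc source-independent) (trans size-source (sym (nonRedundant a)))

    value-other : ∀ h → h ≢ i → h ≢ a → V val h (bundle X' h) ≡ V val h (bundle X h)
    value-other h h≢i h≢a = cong (V val h) (bundle-move-other X i g h≢i h≢a)

    nonRedundant-move : NonRedundant val X'
    nonRedundant-move h with h ≟ i | h ≟ a
    ... | yes refl | _        = trans value-target (trans (cong suc (nonRedundant i)) (sym size-target))
    ... | no  _    | yes refl = source-independent
    ... | no  h≢i  | no  h≢a  = trans (value-other h h≢i h≢a)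
                                  (trans (nonRedundant h) (cong ∣_∣ (sym (bundle-move-other X i g h≢i h≢a))))

    transfer-single : IsTransferPath val X i a [] g
    transfer-single = [] ∷ [] , refl , value-target , value-source , value-other

    transfer-∷ : ∀ {k gs gk} → k ≢ i → k ≢ a → All (g ≢_) (gs ∷ʳ gk) →
                 IsTransferPath val X' a k gs gk → IsTransferPath val X i k (g ∷ gs) gk
    transfer-∷ {k} {gs} {gk} k≢i k≢a g∉path (unique , owner , value-a , value-k , value-rest) =
      g∉path ∷ unique , owner-k , value-i , value-k′ , value-rest′
      where
      path : List (Fin m)
      path = gs ∷ʳ gk
      bundles : ∀ j → bundle (transferAlong X i (g ∷ path)) j ≡ bundle (transferAlong X' a path) j
      bundles = bundle-cong (reassign-∷ X i g path g∉path)
      owner-k : X gk ≡ k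
      owner-k with gk ≟ g
      ... | yes refl = contradiction (sym owner) k≢i
      ... | no  _    = owner
      value-i : V val i (bundle (transferAlong X i (g ∷ path)) i) ≡ suc (V val i (bundle X i))
      value-i = trans (cong (V val i) (bundles i)) (trans (value-rest i (a≢i ∘ sym) (k≢i ∘ sym)) value-target)
      value-k′ : suc (V val k (bundle (transferAlong X i (g ∷ path)) k)) ≡ V val k (bundle X k)
      value-k′ = trans (cong (suc ∘ V val k) (bundles k)) (trans value-k (value-other k k≢i k≢a))
      value-rest′ : ∀ h → h ≢ i → h ≢ k →
                    V val h (bundle (transferAlong X i (g ∷ path)) h) ≡ V val h (bundle X h)
      value-rest′ h h≢i h≢k with h ≟ a
      ... | yes refl = trans (cong (V val a) (bundles a)) (trans value-a value-source)
      ... | no  h≢a  = trans (cong (V val h) (bundles h)) (trans (value-rest h h≢a h≢k) (value-other h h≢i h≢a))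

  module _ (Y : Allocation n m) (nonRedundant-Y : NonRedundant val Y) where

    -- Requiring the path's goods to be disputed keeps a good that was just settled by a
    -- transfer off the path found after that transfer, so prepending it preserves uniqueness.
    PathToSurplus : Allocation n m → Agent n → Set
    PathToSurplus X i =
      Σ (Agent n) λ k → ∣ bundle Y k ∣ < ∣ bundle X k ∣ ×
      Σ (List (Fin m)) λ gs → Σ (Fin m) λ gk →
      IsTransferPath val X i k gs gk × All (λ g → X g ≢ Y g) (gs ∷ʳ gk)

    path-to-surplus : ∀ X → Acc _⊂_ (disputed Y X) → NonRedundant val X →
                      ∀ i → ∣ bundle X i ∣ < ∣ bundle Y i ∣ → PathToSurplus X i
    path-to-surplus X (acc smaller) nonRedundant i deficit
      with MatroidRank.augment (V-isMatroidRank i) (nonRedundant i) (nonRedundant-Y i) deficit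
    ... | g , g∈Yi , g∉Xi , gain = continue (∣ bundle Y a ∣ <? ∣ bundle X a ∣)
      where
      open SingleTransfer X nonRedundant g∉Xi gain
      Yg≡i : Y g ≡ i
      Yg≡i = ∈-bundle⁻ Y g∈Yi
      g-disputed : X g ≢ Y g
      g-disputed Xg≡Yg = a≢i (trans Xg≡Yg Yg≡i)
      g-settled : X' g ≡ Y g
      g-settled = trans (reassign-head X i g []) (sym Yg≡i)
      continue : Dec (∣ bundle Y a ∣ < ∣ bundle X a ∣) → PathToSurplus X i
      continue (yes surplus) = a , surplus , [] , g , transfer-single , g-disputed ∷ []
      continue (no ¬surplus) =
        extend (path-to-surplus X' (smaller (disputed-move-⊂ X Y Yg≡i a≢i)) nonRedundant-move a deficit-a)
        where
        deficit-a : ∣ bundle X' a ∣ < ∣ bundle Y a ∣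
        deficit-a = ≤-trans (≤-reflexive size-source) (≮⇒≥ ¬surplus)
        extend : PathToSurplus X' a → PathToSurplus X i
        extend (k , surplus , gs , gk , path , path-disputed) =
          k , subst (λ p → ∣ bundle Y k ∣ < ∣ p ∣) (bundle-move-other X i g k≢i k≢a) surplus ,
          g ∷ gs , gk , transfer-∷ k≢i k≢a g∉path path , g-disputed ∷ All.map disputed-in-X path-disputed
          where
          k≢a : k ≢ a
          k≢a refl = <-asym surplus deficit-a
          k≢i : k ≢ i
          k≢i refl = <-irrefl refl (<-≤-trans surplus (≤-trans (≤-reflexive size-target) deficit))
          g≢ : ∀ {h} → X' h ≢ Y h → g ≢ h
          g≢ h-disputed refl = h-disputed g-settled
          g∉path : All (g ≢_) (gs ∷ʳ gk)
          g∉path = All.map g≢ path-disputed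
          disputed-in-X : ∀ {h} → X' h ≢ Y h → X h ≢ Y h
          disputed-in-X h-disputed = h-disputed ∘ trans (reassign-tail X i g [] (g≢ h-disputed ∘ sym))

lemma1 : (n m : ℕ) (val : Fin n → Subset m → ℕ) →
    (∀ i → IsMatroidRank (val i)) →
    (X Y : Allocation n m) → NonRedundant val X → NonRedundant val Y →
    (i : Agent n) → ∣ bundle X i ∣ < ∣ bundle Y i ∣ →
    Σ (Agent n) (λ k → ∣ bundle Y k ∣ < ∣ bundle X k ∣ ×
      Σ (List (Fin m)) (λ gs → Σ (Fin m) (λ gk → IsTransferPath val X i k gs gk)))
lemma1 n m val rank X Y nonRedundant-X nonRedundant-Y i deficit
  with path-to-surplus rank Y nonRedundant-Y X (⊂-wellFounded _) nonRedundant-X i deficit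
... | k , surplus , gs , gk , path , _ = k , surplus , gs , gk , path
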